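{- Let $(\alpha,\beta)$ be an admissible pair. Then the address spaces $\Omega^{\bullet}_{(\alpha,\beta,-)}$, $\Omega^{\bullet}_{(\alpha,\beta,+)}$ and $\Omega^{\bullet}_{(\alpha,\beta)}$ are shift invariant.
   Context: Let $\Omega=\{0,1\}^{\infty}$ be the set of infinite strings $\omega=\omega_0\omega_1\omega_2\cdots$ with $\omega_n\in\{0,1\}$. The shift $S:\Omega\to\Omega$ is $S(\omega_0\omega_1\omega_2\cdots)=\omega_1\omega_2\cdots$, and $S^n$ is its $n$-th iterate. The lexicographic order on $\Omega$: $\sigma\prec\omega$ if $\sigma\neq\omega$ and $\sigma_k<\omega_k$ where $k$ is the least index with $\sigma_k\neq\omega_k$; intervals are $[\alpha,\beta]=\{\omega\in\Omega:\alpha\preceq\omega\preceq\beta\}$, and similarly $(\alpha,\beta]$, $[\alpha,\beta)$. Decimals: $\Omega^{\bullet}$ is the set of decimals $\omega_0\omega_1\cdots\omega_N\bullet\omega_{N+1}\omega_{N+2}\cdots$ obtained from some element of $\Omega$ by inserting a decimal point (initial zeros before the point may be added or omitted without changing the decimal). For $\omega\in\Omega^{\bullet}$, $\widehat\omega\in\Omega$ is $\omega$ with the decimal point removed, and for $\Gamma\subseteq\Omega^{\bullet}$, $\widehat\Gamma=\{\widehat\omega:\omega\in\Gamma\}$. For $\Gamma\subseteq\Omega$, $\Gamma^{\bullet}$ is the set of all decimals obtained from strings in $\Gamma$ by placing the decimal point anywhere (e.g. if $\overline{10}\in\Gamma$ then $\bullet 00\overline{10},\bullet0\overline{10},\bullet\overline{10},1\bullet\overline{01},\dots\in\Gamma^{\bullet}$).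 A set $\Gamma\subseteq\Omega^{\bullet}$ is shift invariant if $[S^n(\widehat\Gamma)]^{\bullet}=\Gamma$ for all $n\ge0$. A pair $(\alpha,\beta)$ of elements of $\Omega$ is admissible if (1) $\alpha_0=0,\alpha_1=1$ and $\beta_0=1,\beta_1=0$, and (2) $S^n\alpha\notin(\alpha,\beta]$ and $S^n\beta\notin[\alpha,\beta)$ for all $n\ge 0$. For such a pair define $\Omega_{(\alpha,\beta,-)}=\{\omega\in\Omega: S^n\omega\notin(\alpha,\beta]\ \forall n\ge0\}$, $\Omega_{(\alpha,\beta,+)}=\{\omega\in\Omega: S^n\omega\notin[\alpha,\beta)\ \forall n\ge0\}$, $\Omega^0_{(\alpha,\beta,-)}=\{\omega\in\Omega_{(\alpha,\beta,-)}: 0\omega\preceq\alpha\}$, $\Omega^0_{(\alpha,\beta,+)}=\{\omega\in\Omega_{(\alpha,\beta,+)}: 0\omega\prec\alpha\}$, $\Omega^0_{(\alpha,\beta)}=\Omega^0_{(\alpha,\beta,-)}\cup\Omega^0_{(\alpha,\beta,+)}$, and $\Omega^{\bullet}_{(\alpha,\beta,\pm)}=[\Omega^0_{(\alpha,\beta,\pm)}]^{\bullet}$, $\Omega^{\bullet}_{(\alpha,\beta)}=[\Omega^0_{(\alpha,\beta)}]^{\bullet}$. -}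

module Defs where

open import Data.Nat using (ℕ; zero; suc; _+_; _<_)
open import Data.Bool using (Bool; true; false)
open import Data.Product using (Σ; _×_; _,_; proj₁; proj₂)
open import Data.Sum using (_⊎_)
open import Relation.Nullary using (¬_)
open import Relation.Binary.PropositionalEquality using (_≡_)

-- Ω = {0,1}^∞ ; false encodes the digit 0, true encodes the digit 1.
Ω : Set
Ω = ℕ → Bool

_≐_ : Ω → Ω → Set
σ ≐ ω = ∀ i → σ i ≡ ω i

S : Ω → Ω
S ω i = ω (suc i)

S^ : ℕ → Ω → Ω
S^ zero ω = ω
S^ (suc n) ω = S^ n (S ω)

cons : Bool → Ω → Ω
cons b ω zero = b
cons b ω (suc i) = ω i

zeros : ℕ → Ω → Ω
zeros zero ω = ω
zeros (suc a) ω = cons false (zeros a ω)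

_≺_ : Ω → Ω → Set
σ ≺ ω = Σ ℕ λ k → (∀ i → i < k → σ i ≡ ω i) × (σ k ≡ false) × (ω k ≡ true)

_⪯_ : Ω → Ω → Set
σ ⪯ ω = (σ ≺ ω) ⊎ (σ ≐ ω)

InOC : Ω → Ω → Ω → Set
InOC α β ω = (α ≺ ω) × (ω ⪯ β)

InCO : Ω → Ω → Ω → Set
InCO α β ω = (α ⪯ ω) × (ω ≺ β)

Admissible : Ω → Ω → Set
Admissible α β =
  (α 0 ≡ false) × (α 1 ≡ true) × (β 0 ≡ true) × (β 1 ≡ false) ×
  (∀ n → ¬ InOC α β (S^ n α)) × (∀ n → ¬ InCO α β (S^ n β))

Ω- : Ω → Ω → Ω → Set
Ω- α β ω = ∀ n → ¬ InOC α β (S^ n ω)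

Ω+ : Ω → Ω → Ω → Set
Ω+ α β ω = ∀ n → ¬ InCO α β (S^ n ω)

Ω0- : Ω → Ω → Ω → Set
Ω0- α β ω = Ω- α β ω × (cons false ω ⪯ α)

Ω0+ : Ω → Ω → Ω → Set
Ω0+ α β ω = Ω+ α β ω × (cons false ω ≺ α)

Ω0 : Ω → Ω → Ω → Set
Ω0 α β ω = Ω0- α β ω ⊎ Ω0+ α β ω

-- Decimals: a representative (k , σ) denotes σ₀…σ_{k-1} • σ_k σ_{k+1} …
-- (k = 0: point in front).  Two representatives denote the same decimal
-- iff they agree after prepending suitably many zeros before the point.
Decimal : Set
Decimal = ℕ × Ω

_≈_ : Decimal → Decimal → Set
(k , σ) ≈ (k' , σ') = Σ ℕ λ a → Σ ℕ λ b → (a + k ≡ b + k') × (zeros a σ ≐ zeros b σ')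

_• : (Ω → Set) → Decimal → Set
(Γ •) d = Σ Decimal λ e → Γ (proj₂ e) × (d ≈ e)

hat : (Decimal → Set) → Ω → Set
hat Γ σ = Σ ℕ λ k → Γ (k , σ)

ImS : ℕ → (Ω → Set) → Ω → Set
ImS n A ρ = Σ Ω λ τ → A τ × (S^ n τ ≐ ρ)

ShiftInvariant : (Decimal → Set) → Set
ShiftInvariant Γ = ∀ n d → (((ImS n (hat Γ)) •) d → Γ d) × (Γ d → ((ImS n (hat Γ)) •) d)

-- Let W₋ = {ω ∈ Ω₋ : 0ω ⪯ α}. Every digit string of an address in Ω•₋, and
-- every shift of one, lies in W₋ after removing leading zeros, and conversely
-- 0W₋ ⊆ Ω⁰₋ while prefixing a zero does not change a decimal; so it suffices
-- that W₋ is closed under the shift. This uses only α = 01… and β = 1…: if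
-- ω = 0ω' then ω ≺ β, so α ≺ ω = 0ω' would put ω in (α,β]; if ω = 1ω' then
-- α ≺ 0ω' forces α ≺ 01ω' = 0ω, because a string starting with 0 that lies
-- below ω' also lies below 1ω'. The sets W₊ and W₋ ∪ W₊ work the same way.
module Submission where

open import Defs
open import Level using (0ℓ)
open import Data.Product using (_×_; _,_)
open import Axiom.ExcludedMiddle using (ExcludedMiddle)
open import Data.Nat using (zero; suc; _+_; _<_; z≤n; s≤s)
open import Data.Nat.Properties using (+-suc; +-identityʳ; <-cmp)
open import Data.Bool using (Bool; true; false)
open import Data.Sum using (_⊎_; inj₁; inj₂)
import Data.Sum as Sum
open import Data.Empty using (⊥; ⊥-elim)
open import Relation.Nullary using (¬_)
open import Relation.Binary using (tri<; tri≈; tri>)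
open import Relation.Binary.PropositionalEquality using (_≡_; refl; sym; trans; cong)

true≢false : ∀ {x : Bool} → x ≡ true → x ≡ false → ⊥
true≢false refl ()

≐-refl : ∀ {ω} → ω ≐ ω
≐-refl _ = refl

≐-sym : ∀ {σ ω} → σ ≐ ω → ω ≐ σ
≐-sym p i = sym (p i)

≐-trans : ∀ {σ ω ρ} → σ ≐ ω → ω ≐ ρ → σ ≐ ρ
≐-trans p q i = trans (p i) (q i)

≺-resp-≐ : ∀ {σ σ' ω ω'} → σ ≐ σ' → ω ≐ ω' → σ ≺ ω → σ' ≺ ω'
≺-resp-≐ p q (k , agree , σₖ , ωₖ) =
  k , (λ i i<k → trans (sym (p i)) (trans (agree i i<k) (q i))) ,
  trans (sym (p k)) σₖ , trans (sym (q k)) ωₖ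

⪯-resp-≐ : ∀ {σ σ' ω ω'} → σ ≐ σ' → ω ≐ ω' → σ ⪯ ω → σ' ⪯ ω'
⪯-resp-≐ p q (inj₁ σ≺ω) = inj₁ (≺-resp-≐ p q σ≺ω)
⪯-resp-≐ p q (inj₂ σ≐ω) = inj₂ (≐-trans (≐-sym p) (≐-trans σ≐ω q))

≺-⪯-asym : ∀ {σ ω} → σ ≺ ω → ¬ ω ⪯ σ
≺-⪯-asym (k , _ , σₖ , ωₖ) (inj₂ ω≐σ) = true≢false ωₖ (trans (ω≐σ k) σₖ)
≺-⪯-asym (k , agree , σₖ , ωₖ) (inj₁ (k' , agree' , ωₖ' , σₖ')) with <-cmp k k'
... | tri< k<k' _ _ = true≢false ωₖ (trans (agree' k k<k') σₖ)
... | tri≈ _ refl _ = true≢false ωₖ ωₖ'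
... | tri> _ _ k'<k = true≢false σₖ' (trans (agree k' k'<k) ωₖ')

S^-lookup : ∀ n ω i → S^ n ω i ≡ ω (n + i)
S^-lookup zero ω i = refl
S^-lookup (suc n) ω i = S^-lookup n (S ω) i

S^-resp-≐ : ∀ n {σ ω} → σ ≐ ω → S^ n σ ≐ S^ n ω
S^-resp-≐ n {σ} {ω} p i = trans (S^-lookup n σ i) (trans (p (n + i)) (sym (S^-lookup n ω i)))

S^-zeros : ∀ a ω → S^ a (zeros a ω) ≐ ω
S^-zeros zero ω = ≐-refl
S^-zeros (suc a) ω = S^-zeros a ω

zeros-cons-false : ∀ a ω → zeros a (cons false ω) ≐ cons false (zeros a ω)
zeros-cons-false zero ω = ≐-refl
zeros-cons-false (suc a) ω zero = refl
zeros-cons-false (suc a) ω (suc i) = zeros-cons-false a ω i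

cons-resp-≐ : ∀ b {σ ω} → σ ≐ ω → cons b σ ≐ cons b ω
cons-resp-≐ b p zero = refl
cons-resp-≐ b p (suc i) = p i

cons-head-tail : ∀ {b ω} → ω 0 ≡ b → ω ≐ cons b (S ω)
cons-head-tail ω₀ zero = ω₀
cons-head-tail ω₀ (suc i) = refl

cons-mono-≺ : ∀ b {σ ω} → σ ≺ ω → cons b σ ≺ cons b ω
cons-mono-≺ b (k , agree , σₖ , ωₖ) = suc k , agree' , σₖ , ωₖ
  where
  agree' : ∀ i → i < suc k → cons b _ i ≡ cons b _ i
  agree' zero _ = refl
  agree' (suc i) (s≤s i<k) = agree i i<k

cons-mono-⪯ : ∀ b {σ ω} → σ ⪯ ω → cons b σ ⪯ cons b ω
cons-mono-⪯ b (inj₁ σ≺ω) = inj₁ (cons-mono-≺ b σ≺ω)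
cons-mono-⪯ b (inj₂ σ≐ω) = inj₂ (cons-resp-≐ b σ≐ω)

cons-cancel-≺ : ∀ {b σ ω} → cons b σ ≺ cons b ω → σ ≺ ω
cons-cancel-≺ (zero , _ , refl , ())
cons-cancel-≺ (suc k , agree , σₖ , ωₖ) = k , (λ i i<k → agree (suc i) (s≤s i<k)) , σₖ , ωₖ

-- The first 0 of σ occurs at some index ≤ k; up to there 1ω reads 1 1 … 1.
≺-cons-true : ∀ k {σ ω} → σ k ≡ false → (∀ i → i < k → σ i ≡ ω i) → σ ≺ cons true ω
≺-cons-true zero σₖ _ = zero , (λ _ ()) , σₖ , refl
≺-cons-true (suc k) {σ} {ω} σₖ agree with σ 0 in σ₀
... | false = zero , (λ _ ()) , σ₀ , refl
... | true =
  ≺-resp-≐ (≐-sym (cons-head-tail σ₀)) (cons-resp-≐ true (≐-sym (cons-head-tail ω₀)))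
    (cons-mono-≺ true (≺-cons-true k σₖ (λ i i<k → agree (suc i) (s≤s i<k))))
  where
  ω₀ : ω 0 ≡ true
  ω₀ = trans (sym (agree 0 (s≤s z≤n))) σ₀

≺⇒≺-cons-true : ∀ {σ ω} → σ ≺ ω → σ ≺ cons true ω
≺⇒≺-cons-true (k , agree , σₖ , _) = ≺-cons-true k σₖ agree

-- When σ ≐ ω one cannot decide whether σ contains a 0 (then σ ≺ 1ω) or is
-- the constant string 1 (then σ ≐ 1ω), whence the double negation.
⪯⇒¬¬⪯-cons-true : ∀ {σ ω} → σ ⪯ ω → ¬ ¬ (σ ⪯ cons true ω)
⪯⇒¬¬⪯-cons-true (inj₁ σ≺ω) refute = refute (inj₁ (≺⇒≺-cons-true σ≺ω))
⪯⇒¬¬⪯-cons-true {σ} {ω} (inj₂ σ≐ω) refute = refute (inj₂ σ≐1ω)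
  where
  all-true : ∀ j → σ j ≡ true
  all-true j with σ j in σⱼ
  ... | true = refl
  ... | false = ⊥-elim (refute (inj₁ (≺-cons-true j σⱼ (λ i _ → σ≐ω i))))
  σ≐1ω : σ ≐ cons true ω
  σ≐1ω zero = all-true 0
  σ≐1ω (suc i) = trans (all-true (suc i)) (trans (sym (all-true i)) (σ≐ω i))

≺-cons-insert-true : ∀ {b σ ω} → σ 0 ≡ b → σ ≺ cons b ω → σ ≺ cons b (cons true ω)
≺-cons-insert-true {b} σ₀ σ≺bω =
  ≺-resp-≐ (≐-sym (cons-head-tail σ₀)) ≐-refl
    (cons-mono-≺ b (≺⇒≺-cons-true (cons-cancel-≺ (≺-resp-≐ (cons-head-tail σ₀) ≐-refl σ≺bω))))

⪯-cons-insert-true : ∀ {b σ ω} → σ 0 ≡ b → σ ⪯ cons b ω → ¬ ¬ (σ ⪯ cons b (cons true ω))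
⪯-cons-insert-true σ₀ (inj₁ σ≺bω) refute = refute (inj₁ (≺-cons-insert-true σ₀ σ≺bω))
⪯-cons-insert-true {b} σ₀ (inj₂ σ≐bω) refute =
  ⪯⇒¬¬⪯-cons-true (inj₂ (λ i → σ≐bω (suc i)))
    (λ Sσ⪯1ω → refute (⪯-resp-≐ (≐-sym (cons-head-tail σ₀)) ≐-refl (cons-mono-⪯ b Sσ⪯1ω)))

Avoids : (Ω → Set) → Ω → Set
Avoids P ω = ∀ n → ¬ P (S^ n ω)

avoids-resp-≐ : ∀ {P : Ω → Set} → (∀ {σ ω} → σ ≐ ω → P σ → P ω) →
                ∀ {σ ω} → σ ≐ ω → Avoids P σ → Avoids P ω
avoids-resp-≐ P-resp σ≐ω avoid n p = avoid n (P-resp (S^-resp-≐ n (≐-sym σ≐ω)) p)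

avoids-cons : ∀ {P : Ω → Set} {b ω} → ¬ P (cons b ω) → Avoids P ω → Avoids P (cons b ω)
avoids-cons ¬p _ zero = ¬p
avoids-cons _ avoid (suc n) = avoid n

InOC-resp-≐ : ∀ {α β σ ω} → σ ≐ ω → InOC α β σ → InOC α β ω
InOC-resp-≐ σ≐ω (α≺σ , σ⪯β) = ≺-resp-≐ ≐-refl σ≐ω α≺σ , ⪯-resp-≐ σ≐ω ≐-refl σ⪯β

InCO-resp-≐ : ∀ {α β σ ω} → σ ≐ ω → InCO α β σ → InCO α β ω
InCO-resp-≐ σ≐ω (α⪯σ , σ≺β) = ⪯-resp-≐ ≐-refl σ≐ω α⪯σ , ≺-resp-≐ σ≐ω ≐-refl σ≺β

-- An address space Γ = A• is shift invariant as soon as the strings of A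
-- are the strings 0ω with ω ∈ B, for a set B ⊇ A closed under the shift:
-- B then contains every string of Γ and its shifts, and a zero put in front
-- recovers an element of A denoting the same decimal.
record ShiftEnvelope (A B : Ω → Set) : Set where
  field
    B-resp-≐       : ∀ {σ ω} → σ ≐ ω → B σ → B ω
    A⊆B            : ∀ {ω} → A ω → B ω
    B-shift        : ∀ {ω} → B ω → B (S ω)
    cons-false-B⊆A : ∀ {ω} → B ω → A (cons false ω)

_⊎-envelope_ : ∀ {A₁ B₁ A₂ B₂} → ShiftEnvelope A₁ B₁ → ShiftEnvelope A₂ B₂ →
               ShiftEnvelope (λ ω → A₁ ω ⊎ A₂ ω) (λ ω → B₁ ω ⊎ B₂ ω)
E₁ ⊎-envelope E₂ = record
  { B-resp-≐       = λ σ≐ω → Sum.map (E₁.B-resp-≐ σ≐ω) (E₂.B-resp-≐ σ≐ω)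
  ; A⊆B            = Sum.map E₁.A⊆B E₂.A⊆B
  ; B-shift        = Sum.map E₁.B-shift E₂.B-shift
  ; cons-false-B⊆A = Sum.map E₁.cons-false-B⊆A E₂.cons-false-B⊆A
  }
  where
  module E₁ = ShiftEnvelope E₁
  module E₂ = ShiftEnvelope E₂

≈-pad-zero : ∀ {d k ρ} → d ≈ (k , ρ) → d ≈ (suc k , cons false ρ)
≈-pad-zero {k = k} {ρ} (a , b , a+l≡b+k , zeros-agree) =
  suc a , b , trans (cong suc a+l≡b+k) (sym (+-suc b k)) ,
  ≐-trans (cons-resp-≐ false zeros-agree) (≐-sym (zeros-cons-false b ρ))

module _ {A B : Ω → Set} (E : ShiftEnvelope A B) where
  open ShiftEnvelope E

  zeros-B : ∀ a {ω} → B ω → B (zeros a ω)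
  zeros-B zero Bω = Bω
  zeros-B (suc a) Bω = A⊆B (cons-false-B⊆A (zeros-B a Bω))

  S^-B : ∀ n {ω} → B ω → B (S^ n ω)
  S^-B zero Bω = Bω
  S^-B (suc n) Bω = S^-B n (B-shift Bω)

  hat-•⊆B : ∀ {σ} → hat (A •) σ → B σ
  hat-•⊆B {σ} (_ , (_ , υ) , Aυ , a , b , _ , zeros-agree) =
    B-resp-≐ (≐-trans (S^-resp-≐ a (≐-sym zeros-agree)) (S^-zeros a σ))
      (S^-B a (zeros-B b (A⊆B Aυ)))

  •-ImS-hat⊆• : ∀ n {d} → (ImS n (hat (A •)) •) d → (A •) d
  •-ImS-hat⊆• n ((k , ρ) , (τ , τ∈hat , S^τ≐ρ) , d≈) =
    (suc k , cons false ρ) ,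
    cons-false-B⊆A (B-resp-≐ S^τ≐ρ (S^-B n (hat-•⊆B τ∈hat))) ,
    ≈-pad-zero d≈

  •⊆•-ImS-hat : ∀ n {d} → (A •) d → (ImS n (hat (A •)) •) d
  •⊆•-ImS-hat n ((k , υ) , Aυ , d≈) =
    (k , υ) , (zeros n υ , zeros-υ∈hat , S^-zeros n υ) , d≈
    where
    zeros-υ∈hat : hat (A •) (zeros n υ)
    zeros-υ∈hat = n , (0 , υ) , Aυ , 0 , n , sym (+-identityʳ n) , ≐-refl

  envelope⇒shiftInvariant : ShiftInvariant (A •)
  envelope⇒shiftInvariant n d = •-ImS-hat⊆• n , •⊆•-ImS-hat n

-- Classically WeakΩ0- = Ω0- and WeakΩ0+ = Ω0+; the negated comparisons with α
-- are what survives the shift without excluded middle.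
WeakΩ0- : Ω → Ω → Ω → Set
WeakΩ0- α β ω = Ω- α β ω × ¬ (α ≺ cons false ω)

WeakΩ0+ : Ω → Ω → Ω → Set
WeakΩ0+ α β ω = Ω+ α β ω × ¬ (α ⪯ cons false ω)

module _ {α β : Ω} (α₀ : α 0 ≡ false) (α₁ : α 1 ≡ true) (β₀ : β 0 ≡ true) where

  cons-false-false-≺ : ∀ ω → cons false (cons false ω) ≺ α
  cons-false-false-≺ ω = 1 , agree , refl , α₁
    where
    agree : ∀ i → i < 1 → cons false (cons false ω) i ≡ α i
    agree zero _ = sym α₀
    agree (suc i) (s≤s ())

  cons-false-≺β : ∀ {ω} → ω 0 ≡ false → ω ≺ β
  cons-false-≺β ω₀ = zero , (λ _ ()) , ω₀ , β₀

  WeakΩ0--shift : ∀ {ω} → WeakΩ0- α β ω → WeakΩ0- α β (S ω)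
  WeakΩ0--shift {ω} (avoid , α⊀0ω) = (λ n → avoid (suc n)) , α⊀0Sω
    where
    α⊀0Sω : ¬ (α ≺ cons false (S ω))
    α⊀0Sω α≺0Sω with ω 0 in ω₀
    ... | false = avoid 0 (≺-resp-≐ ≐-refl (≐-sym (cons-head-tail ω₀)) α≺0Sω ,
                           inj₁ (cons-false-≺β ω₀))
    ... | true = α⊀0ω (≺-resp-≐ ≐-refl (cons-resp-≐ false (≐-sym (cons-head-tail ω₀)))
                         (≺-cons-insert-true α₀ α≺0Sω))

  WeakΩ0+-shift : ∀ {ω} → WeakΩ0+ α β ω → WeakΩ0+ α β (S ω)
  WeakΩ0+-shift {ω} (avoid , α⋠0ω) = (λ n → avoid (suc n)) , α⋠0Sω
    where
    α⋠0Sω : ¬ (α ⪯ cons false (S ω))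
    α⋠0Sω α⪯0Sω with ω 0 in ω₀
    ... | false = avoid 0 (⪯-resp-≐ ≐-refl (≐-sym (cons-head-tail ω₀)) α⪯0Sω ,
                           cons-false-≺β ω₀)
    ... | true = ⪯-cons-insert-true α₀ α⪯0Sω
                   (λ α⪯01Sω → α⋠0ω (⪯-resp-≐ ≐-refl
                     (cons-resp-≐ false (≐-sym (cons-head-tail ω₀))) α⪯01Sω))

  Ω0--envelope : ShiftEnvelope (Ω0- α β) (WeakΩ0- α β)
  Ω0--envelope = record
    { B-resp-≐       = λ σ≐ω (avoid , α⊀0σ) →
        avoids-resp-≐ InOC-resp-≐ σ≐ω avoid ,
        λ α≺0ω → α⊀0σ (≺-resp-≐ ≐-refl (cons-resp-≐ false (≐-sym σ≐ω)) α≺0ω)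
    ; A⊆B            = λ (avoid , 0ω⪯α) → avoid , λ α≺0ω → ≺-⪯-asym α≺0ω 0ω⪯α
    ; B-shift        = WeakΩ0--shift
    ; cons-false-B⊆A = λ (avoid , α⊀0ω) →
        avoids-cons {InOC α β} (λ (α≺0ω , _) → α⊀0ω α≺0ω) avoid , inj₁ (cons-false-false-≺ _)
    }

  Ω0+-envelope : ShiftEnvelope (Ω0+ α β) (WeakΩ0+ α β)
  Ω0+-envelope = record
    { B-resp-≐       = λ σ≐ω (avoid , α⋠0σ) →
        avoids-resp-≐ InCO-resp-≐ σ≐ω avoid ,
        λ α⪯0ω → α⋠0σ (⪯-resp-≐ ≐-refl (cons-resp-≐ false (≐-sym σ≐ω)) α⪯0ω)
    ; A⊆B            = λ (avoid , 0ω≺α) → avoid , ≺-⪯-asym 0ω≺α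
    ; B-shift        = WeakΩ0+-shift
    ; cons-false-B⊆A = λ (avoid , α⋠0ω) →
        avoids-cons {InCO α β} (λ (α⪯0ω , _) → α⋠0ω α⪯0ω) avoid , cons-false-false-≺ _
    }

-- The argument is constructive.
mainTheorem2 : ExcludedMiddle 0ℓ → (α β : Ω) → Admissible α β →
    ShiftInvariant (Ω0- α β •) × ShiftInvariant (Ω0+ α β •) × ShiftInvariant (Ω0 α β •)
mainTheorem2 _ α β (α₀ , α₁ , β₀ , _) =
  envelope⇒shiftInvariant Ω0-E ,
  envelope⇒shiftInvariant Ω0+E ,
  envelope⇒shiftInvariant (Ω0-E ⊎-envelope Ω0+E)
  where
  Ω0-E = Ω0--envelope α₀ α₁ β₀
  Ω0+E = Ω0+-envelope α₀ α₁ β₀
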